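{- Let $n$ be odd and let $f$ be the standardly semilinear $n$-ary quasigroup of order $4$ defined by a Boolean function $\lambda:\mathbb{Z}_2^n\to\mathbb{Z}_2$. Then the number of transversals $\{\alpha^1,\alpha^2,\alpha^3,\alpha^4\}$ of $f$ for which $\{l(\alpha^1),l(\alpha^2),l(\alpha^3),l(\alpha^4)\}$ is a twin quadruple equals $8^{n-1}$.
   Context: Let $\Sigma_4=\{0,1,2,3\}$ and $l:\Sigma_4\to\mathbb{Z}_2$, $l(0)=l(1)=0$, $l(2)=l(3)=1$, applied coordinate-wise to vectors. The standardly semilinear quasigroup defined by $\lambda$ is the map $f:\Sigma_4^n\to\Sigma_4$ such that for all $x_0,\dots,x_n\in\Sigma_4$: $x_0=f(x_1,\dots,x_n)$ iff $l(x_0)+\dots+l(x_n)\equiv0\pmod2$ and $x_0+\dots+x_n+\lambda(l(x_1),\dots,l(x_n))\equiv0\pmod2$ (integer sums). A transversal in $f$ is a set of $4$ vectors $\alpha^i=(a^i_0,\dots,a^i_n)\in\Sigma_4^{n+1}$ with $a^i_0=f(a^i_1,\dots,a^i_n)$ for all $i$ and $a^i_k\ne a^j_k$ for all $i\ne j$ and all $k$. A quadruple is a multiset of four Boolean vectors; a quadruple of $(n+1)$-vectors is proper if in every coordinate its four entries form the multiset $\{0,0,1,1\}$; worthwhile if it is proper and each vector has even weight (even number of ones); twin if it is worthwhile and consists of two pairs of identical vectors. -}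

module Defs where

open import Data.Nat using (ℕ; zero; suc; _+_; _%_)
open import Data.Nat.Properties using () renaming (_≟_ to _≟ℕ_)
open import Data.Bool using (Bool; true; false)
import Data.Bool.Properties as BoolP
open import Data.Fin using (Fin; zero; suc; toℕ)
open import Data.Fin.Properties using (all?) renaming (_≟_ to _≟F_)
open import Data.Vec using (Vec; []; _∷_; lookup; map; foldr)
open import Data.Vec.Properties using (≡-dec)
open import Data.List using (List; []; _∷_; concatMap; filter; length)
import Data.List as L
open import Data.Product using (_×_)
open import Data.Sum using (_⊎_)
open import Relation.Binary.PropositionalEquality using (_≡_; _≢_)
open import Relation.Nullary using (Dec; ¬?; _×-dec_; _⊎-dec_; _→-dec_)

Σ₄ : Set
Σ₄ = Fin 4

l : Σ₄ → Bool
l zero = false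
l (suc zero) = false
l (suc (suc _)) = true

b2n : Bool → ℕ
b2n false = 0
b2n true = 1

weight : ∀ {m} → Vec Bool m → ℕ
weight = foldr _ (λ b s → b2n b + s) 0

sumΣ : ∀ {m} → Vec Σ₄ m → ℕ
sumΣ = foldr _ (λ x s → toℕ x + s) 0

Even : ℕ → Set
Even k = k % 2 ≡ 0

Odd : ℕ → Set
Odd k = k % 2 ≡ 1

-- The graph of the standardly semilinear quasigroup defined by λ:
-- for a vector (x₀, x₁, …, xₙ), the relation x₀ = f(x₁,…,xₙ) holds iff
-- l(x₀)+…+l(xₙ) ≡ 0 mod 2 and x₀+…+xₙ+λ(l(x₁),…,l(xₙ)) ≡ 0 mod 2.
IsValue : ∀ {n} → (Vec Bool n → Bool) → Vec Σ₄ (suc n) → Set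
IsValue λf (x₀ ∷ xs) =
  Even (weight (map l (x₀ ∷ xs))) × Even (sumΣ (x₀ ∷ xs) + b2n (λf (map l xs)))

-- An ordered transversal: four vectors α¹..α⁴ ∈ Σ₄^{n+1} (coordinate 0 is a₀),
-- each satisfying a₀ = f(a₁,…,aₙ), and pairwise distinct in every coordinate.
IsTransversal : ∀ {n} → (Vec Bool n → Bool) → Vec (Vec Σ₄ (suc n)) 4 → Set
IsTransversal λf α =
  (∀ i → IsValue λf (lookup α i)) ×
  (∀ i j → i ≢ j → ∀ k → lookup (lookup α i) k ≢ lookup (lookup α j) k)

-- Quadruples of Boolean m-vectors (as ordered 4-tuples; the multiset is the
-- multiset of entries).
-- proper: in every coordinate the four entries form the multiset {0,0,1,1},
-- i.e. exactly two of the four entries are 1.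
Proper : ∀ {m} → Vec (Vec Bool m) 4 → Set
Proper q = ∀ k → weight (map (λ v → lookup v k) q) ≡ 2

Worthwhile : ∀ {m} → Vec (Vec Bool m) 4 → Set
Worthwhile q = Proper q × (∀ i → Even (weight (lookup q i)))

Twin : ∀ {m} → Vec (Vec Bool m) 4 → Set
Twin (a ∷ b ∷ c ∷ d ∷ []) =
  Worthwhile (a ∷ b ∷ c ∷ d ∷ []) ×
  ((a ≡ b × c ≡ d) ⊎ (a ≡ c × b ≡ d) ⊎ (a ≡ d × b ≡ c))

even? : ∀ k → Dec (Even k)
even? k = (k % 2) ≟ℕ 0

isValue? : ∀ {n} (λf : Vec Bool n → Bool) v → Dec (IsValue λf v)
isValue? λf (x₀ ∷ xs) =
  even? (weight (map l (x₀ ∷ xs))) ×-dec even? (sumΣ (x₀ ∷ xs) + b2n (λf (map l xs)))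

isTransversal? : ∀ {n} (λf : Vec Bool n → Bool) α → Dec (IsTransversal λf α)
isTransversal? λf α =
  all? (λ i → isValue? λf (lookup α i)) ×-dec
  all? (λ i → all? (λ j → ¬? (i ≟F j) →-dec
    all? (λ k → ¬? (lookup (lookup α i) k ≟F lookup (lookup α j) k))))

proper? : ∀ {m} (q : Vec (Vec Bool m) 4) → Dec (Proper q)
proper? q = all? (λ k → weight (map (λ v → lookup v k) q) ≟ℕ 2)

worthwhile? : ∀ {m} (q : Vec (Vec Bool m) 4) → Dec (Worthwhile q)
worthwhile? q = proper? q ×-dec all? (λ i → even? (weight (lookup q i)))

twin? : ∀ {m} (q : Vec (Vec Bool m) 4) → Dec (Twin q)
twin? (a ∷ b ∷ c ∷ d ∷ []) =
  worthwhile? _ ×-dec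
  ((a ≟V b ×-dec c ≟V d) ⊎-dec (a ≟V c ×-dec b ≟V d) ⊎-dec (a ≟V d ×-dec b ≟V c))
  where _≟V_ = ≡-dec BoolP._≟_

allΣ₄ : List Σ₄
allΣ₄ = zero ∷ suc zero ∷ suc (suc zero) ∷ suc (suc (suc zero)) ∷ []

vecsOf : ∀ {A : Set} → List A → (m : ℕ) → List (Vec A m)
vecsOf xs zero = [] ∷ []
vecsOf xs (suc m) = concatMap (λ x → L.map (x ∷_) (vecsOf xs m)) xs

allQuads : (n : ℕ) → List (Vec (Vec Σ₄ (suc n)) 4)
allQuads n = vecsOf (vecsOf allΣ₄ (suc n)) 4

TwinTransversal : ∀ {n} → (Vec Bool n → Bool) → Vec (Vec Σ₄ (suc n)) 4 → Set
TwinTransversal λf α = IsTransversal λf α × Twin (map (map l) α)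

countOrderedTwinTransversals : (n : ℕ) → (Vec Bool n → Bool) → ℕ
countOrderedTwinTransversals n λf =
  length (filter (λ α → isTransversal? λf α ×-dec twin? (map (map l) α)) (allQuads n))

module Submission where

-- Order a twin transversal (a, b, c, d) so that a and b carry equal labels,
-- and c and d too. Two distinct symbols with the same label are mates
-- (0 ↔ 1, 2 ↔ 3), so b = mate a and d = mate c, and c, being distinct from
-- both a and mate a in every coordinate, carries the complementary label.
-- Conversely, mating a vector flips the parity of each of its n + 1 entries;
-- for odd n this keeps the parity of the coordinate sum, so mate a is a value
-- of f whenever a is, and every pair of values a, c with complementary labels
-- gives such a transversal. A label of even weight is carried by exactly 2ⁿ
-- values (the first coordinate fixes the parity), there are 2ⁿ such labels,
-- and the three ways of pairing up the last three rows give
-- 3 · 4ⁿ · 2ⁿ = 3 · 8ⁿ ordered transversals.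

open import Defs
open import Data.Bool using (Bool; true; false; not; _xor_)
open import Data.Bool.Properties
  using (not-involutive; not-¬; ¬-not; not-distribˡ-xor; not-distribʳ-xor; xor-assoc; xor-identityʳ)
import Data.Bool.Properties as Bool
open import Data.Empty using (⊥; ⊥-elim)
open import Data.Fin using (zero; suc; toℕ; #_)
open import Data.Fin.Properties using () renaming (_≟_ to _≟F_)
open import Data.List using (List; []; _∷_; _++_; concatMap; filter; length)
import Data.List as List
open import Data.Nat using (ℕ; zero; suc; _+_; _*_; _^_; _∸_)
open import Data.Nat.Properties
open import Algebra.Properties.CommutativeSemigroup +-commutativeSemigroup
  using (interchange) renaming (xy∙z≈y∙xz to +-xy∙z≈y∙xz)
open import Algebra.Properties.CommutativeSemigroup *-commutativeSemigroup
  using () renaming (interchange to *-interchange; xy∙z≈y∙xz to *-xy∙z≈y∙xz;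
                    x∙yz≈y∙xz to *-x∙yz≈y∙xz)
open import Data.Product using (_×_; _,_; proj₁; proj₂)
open import Data.Sum using (_⊎_; inj₁; inj₂)
open import Data.Vec using (Vec; []; _∷_; map; lookup; foldr)
open import Data.Vec.Properties using (≡-dec; ∷-injective; map-id; lookup-map)
open import Data.Vec.Relation.Binary.Pointwise.Extensional using (ext; extensional⇒inductive)
open import Data.Vec.Relation.Binary.Pointwise.Inductive as Pointwise using (Pointwise; []; _∷_)
open import Function using (id; _∘_)
open import Relation.Binary using (DecidableEquality)
open import Relation.Binary.PropositionalEquality
open import Relation.Nullary using (Dec; yes; no; ¬_; does; _×-dec_; _⊎-dec_)
open import Relation.Unary using (Decidable)

private
  variable
    A B : Set

∑ : List A → (A → ℕ) → ℕ
∑ []       f = 0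
∑ (x ∷ xs) f = f x + ∑ xs f

infix 5 ∑
syntax ∑ xs (λ x → e) = ∑[ x ∈ xs ] e

∑-zero : ∀ (xs : List A) → ∑ xs (λ _ → 0) ≡ 0
∑-zero []       = refl
∑-zero (x ∷ xs) = ∑-zero xs

∑-cong : ∀ (xs : List A) {f g : A → ℕ} → (∀ x → f x ≡ g x) → ∑ xs f ≡ ∑ xs g
∑-cong []       f≗g = refl
∑-cong (x ∷ xs) f≗g = cong₂ _+_ (f≗g x) (∑-cong xs f≗g)

∑-++ : ∀ (xs ys : List A) f → ∑ (xs ++ ys) f ≡ ∑ xs f + ∑ ys f
∑-++ []       ys f = refl
∑-++ (x ∷ xs) ys f = trans (cong (f x +_) (∑-++ xs ys f)) (sym (+-assoc (f x) _ _))

∑-+ : ∀ (xs : List A) f g → ∑[ x ∈ xs ] (f x + g x) ≡ ∑ xs f + ∑ xs g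
∑-+ []       f g = refl
∑-+ (x ∷ xs) f g = trans (cong (f x + g x +_) (∑-+ xs f g)) (interchange (f x) (g x) _ _)

∑-*ˡ : ∀ (xs : List A) k f → ∑[ x ∈ xs ] k * f x ≡ k * ∑ xs f
∑-*ˡ []       k f = sym (*-zeroʳ k)
∑-*ˡ (x ∷ xs) k f = trans (cong (k * f x +_) (∑-*ˡ xs k f)) (sym (*-distribˡ-+ k (f x) _))

∑-*ʳ : ∀ (xs : List A) k f → ∑[ x ∈ xs ] f x * k ≡ ∑ xs f * k
∑-*ʳ xs k f = trans (∑-cong xs (λ x → *-comm (f x) k)) (trans (∑-*ˡ xs k f) (*-comm k _))

∑-comm : ∀ (xs : List A) (ys : List B) (f : A → B → ℕ) →
         ∑[ x ∈ xs ] ∑[ y ∈ ys ] f x y ≡ ∑[ y ∈ ys ] ∑[ x ∈ xs ] f x y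
∑-comm []       ys f = sym (∑-zero ys)
∑-comm (x ∷ xs) ys f = trans (cong (∑ ys (f x) +_) (∑-comm xs ys f)) (sym (∑-+ ys (f x) _))

∑-map : ∀ (xs : List A) (h : A → B) (g : B → ℕ) → ∑ (List.map h xs) g ≡ ∑[ x ∈ xs ] g (h x)
∑-map []       h g = refl
∑-map (x ∷ xs) h g = cong (g (h x) +_) (∑-map xs h g)

∑-concatMap : ∀ (xs : List A) (h : A → List B) (g : B → ℕ) →
              ∑ (concatMap h xs) g ≡ ∑[ x ∈ xs ] ∑ (h x) g
∑-concatMap []       h g = refl
∑-concatMap (x ∷ xs) h g = trans (∑-++ (h x) _ g) (cong (∑ (h x) g +_) (∑-concatMap xs h g))

∑³ : List A → (A → A → A → ℕ) → ℕ
∑³ xs F = ∑[ b ∈ xs ] ∑[ c ∈ xs ] ∑[ d ∈ xs ] F b c d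

∑³-+ : ∀ (xs : List A) F G → ∑³ xs (λ b c d → F b c d + G b c d) ≡ ∑³ xs F + ∑³ xs G
∑³-+ xs F G =
  trans (∑-cong xs (λ b → trans (∑-cong xs (λ c → ∑-+ xs (F b c) (G b c))) (∑-+ xs _ _)))
        (∑-+ xs _ _)

∑³-swap₁₂ : ∀ (xs : List A) F → ∑³ xs (λ b c d → F c b d) ≡ ∑³ xs F
∑³-swap₁₂ xs F = ∑-comm xs xs (λ b c → ∑[ d ∈ xs ] F c b d)

∑³-rotate : ∀ (xs : List A) F → ∑³ xs (λ b c d → F d b c) ≡ ∑³ xs F
∑³-rotate xs F =
  trans (∑-cong xs (λ b → ∑-comm xs xs (λ c d → F d b c)))
        (∑-comm xs xs (λ b d → ∑[ c ∈ xs ] F d b c))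

∑-vecsOf-suc : ∀ (xs : List A) m (g : Vec A (suc m) → ℕ) →
               ∑ (vecsOf xs (suc m)) g ≡ ∑[ x ∈ xs ] ∑[ v ∈ vecsOf xs m ] g (x ∷ v)
∑-vecsOf-suc xs m g =
  trans (∑-concatMap xs _ g) (∑-cong xs (λ x → ∑-map (vecsOf xs m) (x ∷_) g))

∑-quads : ∀ (xs : List A) (g : Vec A 4 → ℕ) →
          ∑ (vecsOf xs 4) g ≡ ∑[ a ∈ xs ] ∑³ xs (λ b c d → g (a ∷ b ∷ c ∷ d ∷ []))
∑-quads xs g =
  trans (∑-vecsOf-suc xs 3 g) (∑-cong xs λ a →
  trans (∑-vecsOf-suc xs 2 _) (∑-cong xs λ b →
  trans (∑-vecsOf-suc xs 1 _) (∑-cong xs λ c →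
  trans (∑-vecsOf-suc xs 0 _) (∑-cong xs λ d → +-identityʳ _))))

𝟙 : {P : Set} → Dec P → ℕ
𝟙 p = b2n (does p)

module _ {P Q : Set} where

  𝟙-cong : (p : Dec P) (q : Dec Q) → (P → Q) → (Q → P) → 𝟙 p ≡ 𝟙 q
  𝟙-cong (yes _) (yes _) _   _   = refl
  𝟙-cong (yes x) (no ¬y) P→Q _   = ⊥-elim (¬y (P→Q x))
  𝟙-cong (no ¬x) (yes y) _   Q→P = ⊥-elim (¬x (Q→P y))
  𝟙-cong (no _)  (no _)  _   _   = refl

  𝟙-× : (p : Dec P) (q : Dec Q) → 𝟙 (p ×-dec q) ≡ 𝟙 p * 𝟙 q
  𝟙-× (yes _) q = sym (+-identityʳ (𝟙 q))
  𝟙-× (no _)  q = refl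

  𝟙-⊎ : (p : Dec P) (q : Dec Q) → ¬ (P × Q) → 𝟙 (p ⊎-dec q) ≡ 𝟙 p + 𝟙 q
  𝟙-⊎ (yes x) (yes y) disjoint = ⊥-elim (disjoint (x , y))
  𝟙-⊎ (yes _) (no _)  _        = refl
  𝟙-⊎ (no _)  q       _        = refl

𝟙-yes : ∀ {P : Set} (p : Dec P) → P → 𝟙 p ≡ 1
𝟙-yes (yes _) _ = refl
𝟙-yes (no ¬x) x = ⊥-elim (¬x x)

𝟙-guard : ∀ {P : Set} (p : Dec P) {x y : ℕ} → (P → x ≡ y) → 𝟙 p * x ≡ 𝟙 p * y
𝟙-guard (yes p) x≡y = cong (_+ 0) (x≡y p)
𝟙-guard (no _)  _   = refl

length-filter≡∑ : ∀ {P : A → Set} (P? : Decidable P) (xs : List A) →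
                  length (filter P? xs) ≡ ∑[ x ∈ xs ] 𝟙 (P? x)
length-filter≡∑ P? []       = refl
length-filter≡∑ P? (x ∷ xs) with does (P? x)
... | true  = cong suc (length-filter≡∑ P? xs)
... | false = length-filter≡∑ P? xs

^-distribʳ-* : ∀ m n k → (m * n) ^ k ≡ m ^ k * n ^ k
^-distribʳ-* m n zero    = refl
^-distribʳ-* m n (suc k) = begin
  m * n * (m * n) ^ k        ≡⟨ cong (m * n *_) (^-distribʳ-* m n k) ⟩
  m * n * (m ^ k * n ^ k)    ≡⟨ *-interchange m n (m ^ k) (n ^ k) ⟩
  m * m ^ k * (n * n ^ k)    ∎
  where open ≡-Reasoning

module _ {B : Set} (_≟_ : DecidableEquality B) where

  ∑-fibre-vecsOf : ∀ (h : A → B) (xs : List A) k → (∀ y → ∑[ x ∈ xs ] 𝟙 (h x ≟ y) ≡ k) →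
                   ∀ m (w : Vec B m) → ∑[ v ∈ vecsOf xs m ] 𝟙 (≡-dec _≟_ (map h v) w) ≡ k ^ m
  ∑-fibre-vecsOf h xs k fibre zero    []      = refl
  ∑-fibre-vecsOf h xs k fibre (suc m) (y ∷ w) = begin
    ∑[ v ∈ vecsOf xs (suc m) ] 𝟙 (≡-dec _≟_ (map h v) (y ∷ w))
      ≡⟨ ∑-vecsOf-suc xs m _ ⟩
    ∑[ x ∈ xs ] ∑[ v ∈ vecsOf xs m ] 𝟙 (h x ≟ y ×-dec ≡-dec _≟_ (map h v) w)
      ≡⟨ ∑-cong xs (λ x → ∑-cong (vecsOf xs m) (λ v → 𝟙-× (h x ≟ y) (≡-dec _≟_ (map h v) w))) ⟩
    ∑[ x ∈ xs ] ∑[ v ∈ vecsOf xs m ] 𝟙 (h x ≟ y) * 𝟙 (≡-dec _≟_ (map h v) w)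
      ≡⟨ ∑-cong xs (λ x → ∑-*ˡ (vecsOf xs m) (𝟙 (h x ≟ y)) _) ⟩
    ∑[ x ∈ xs ] 𝟙 (h x ≟ y) * (∑[ v ∈ vecsOf xs m ] 𝟙 (≡-dec _≟_ (map h v) w))
      ≡⟨ ∑-cong xs (λ x → cong (𝟙 (h x ≟ y) *_) (∑-fibre-vecsOf h xs k fibre m w)) ⟩
    ∑[ x ∈ xs ] 𝟙 (h x ≟ y) * k ^ m
      ≡⟨ ∑-*ʳ xs (k ^ m) _ ⟩
    (∑[ x ∈ xs ] 𝟙 (h x ≟ y)) * k ^ m
      ≡⟨ cong (_* k ^ m) (fibre y) ⟩
    k * k ^ m ∎
    where open ≡-Reasoning

  ∑-δ-vecsOf : ∀ (xs : List B) → (∀ y → ∑[ x ∈ xs ] 𝟙 (x ≟ y) ≡ 1) →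
               ∀ m (w : Vec B m) K → ∑[ v ∈ vecsOf xs m ] 𝟙 (≡-dec _≟_ v w) * K ≡ K
  ∑-δ-vecsOf xs once m w K = begin
    ∑[ v ∈ vecsOf xs m ] 𝟙 (≡-dec _≟_ v w) * K
      ≡⟨ ∑-*ʳ (vecsOf xs m) K _ ⟩
    (∑[ v ∈ vecsOf xs m ] 𝟙 (≡-dec _≟_ v w)) * K
      ≡⟨ cong (_* K) (∑-cong (vecsOf xs m) (λ v → cong (λ u → 𝟙 (≡-dec _≟_ u w)) (sym (map-id v)))) ⟩
    (∑[ v ∈ vecsOf xs m ] 𝟙 (≡-dec _≟_ (map id v) w)) * K
      ≡⟨ cong (_* K) (∑-fibre-vecsOf id xs 1 once m w) ⟩
    1 ^ m * K
      ≡⟨ cong (_* K) (^-zeroˡ m) ⟩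
    1 * K
      ≡⟨ *-identityˡ K ⟩
    K ∎
    where open ≡-Reasoning

parity : ℕ → Bool
parity zero    = false
parity (suc k) = not (parity k)

parity-+ : ∀ a b → parity (a + b) ≡ parity a xor parity b
parity-+ zero    b = refl
parity-+ (suc a) b = trans (cong not (parity-+ a b)) (not-distribˡ-xor (parity a) (parity b))

even⇒parity≡false : ∀ k → Even k → parity k ≡ false
even⇒parity≡false zero          _    = refl
even⇒parity≡false (suc zero)    ()
even⇒parity≡false (suc (suc k)) even = trans (not-involutive (parity k)) (even⇒parity≡false k even)

parity≡false⇒even : ∀ k → parity k ≡ false → Even k
parity≡false⇒even zero          _ = refl
parity≡false⇒even (suc zero)    ()
parity≡false⇒even (suc (suc k)) p = parity≡false⇒even k (trans (sym (not-involutive (parity k))) p)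

odd⇒parity≡true : ∀ k → Odd k → parity k ≡ true
odd⇒parity≡true zero          ()
odd⇒parity≡true (suc zero)    _   = refl
odd⇒parity≡true (suc (suc k)) odd = trans (not-involutive (parity k)) (odd⇒parity≡true k odd)

even-parity-cong : ∀ a b → parity a ≡ parity b → Even a → Even b
even-parity-cong a b pa≡pb even = parity≡false⇒even b (trans (sym pa≡pb) (even⇒parity≡false a even))

parity-+-congˡ : ∀ a a′ b → parity a ≡ parity a′ → parity (a + b) ≡ parity (a′ + b)
parity-+-congˡ a a′ b pa≡pa′ =
  trans (parity-+ a b) (trans (cong (_xor parity b) pa≡pa′) (sym (parity-+ a′ b)))

parity-b2n-not : ∀ b → parity (b2n (not b)) ≡ not (parity (b2n b))
parity-b2n-not false = refl
parity-b2n-not true  = refl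

mate : Σ₄ → Σ₄
mate zero                   = suc zero
mate (suc zero)             = zero
mate (suc (suc zero))       = suc (suc (suc zero))
mate (suc (suc (suc zero))) = suc (suc zero)

l-mate : ∀ x → l (mate x) ≡ l x
l-mate zero                   = refl
l-mate (suc zero)             = refl
l-mate (suc (suc zero))       = refl
l-mate (suc (suc (suc zero))) = refl

parity-mate : ∀ x → parity (toℕ (mate x)) ≡ not (parity (toℕ x))
parity-mate zero                   = refl
parity-mate (suc zero)             = refl
parity-mate (suc (suc zero))       = refl
parity-mate (suc (suc (suc zero))) = refl

mate-≢ : ∀ x → x ≢ mate x
mate-≢ zero                   ()
mate-≢ (suc zero)             ()
mate-≢ (suc (suc zero))       ()
mate-≢ (suc (suc (suc zero))) ()

same-label : ∀ x y → l x ≡ l y → y ≡ x ⊎ y ≡ mate x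
same-label zero                   zero                   _  = inj₁ refl
same-label zero                   (suc zero)             _  = inj₂ refl
same-label zero                   (suc (suc _))          ()
same-label (suc zero)             zero                   _  = inj₂ refl
same-label (suc zero)             (suc zero)             _  = inj₁ refl
same-label (suc zero)             (suc (suc _))          ()
same-label (suc (suc _))          zero                   ()
same-label (suc (suc _))          (suc zero)             ()
same-label (suc (suc zero))       (suc (suc zero))       _  = inj₁ refl
same-label (suc (suc zero))       (suc (suc (suc zero))) _  = inj₂ refl
same-label (suc (suc (suc zero))) (suc (suc zero))       _  = inj₂ refl
same-label (suc (suc (suc zero))) (suc (suc (suc zero))) _  = inj₁ refl

same-label⇒mate : ∀ {x y} → x ≢ y → l x ≡ l y → y ≡ mate x
same-label⇒mate {x} {y} x≢y lx≡ly with same-label x y lx≡ly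
... | inj₁ y≡x    = ⊥-elim (x≢y (sym y≡x))
... | inj₂ y≡mate = y≡mate

other-label : ∀ {x y} → x ≢ y → mate x ≢ y → l y ≡ not (l x)
other-label {x} {y} x≢y mate≢y = ¬-not λ ly≡lx → mate≢y (sym (same-label⇒mate x≢y (sym ly≡lx)))

other-label⇒≢ : ∀ {x y} → l y ≡ not (l x) → x ≢ y
other-label⇒≢ ly≡not refl = not-¬ refl ly≡not

-- Both weight and sumΣ are sumWith, definitionally.
sumWith : ∀ {m} → (A → ℕ) → Vec A m → ℕ
sumWith g = foldr _ (λ x s → g x + s) 0

parity-sumWith-map : ∀ (g : A → ℕ) (h : A → A) → (∀ x → parity (g (h x)) ≡ not (parity (g x))) →
                     ∀ {m} (v : Vec A m) → parity (sumWith g (map h v)) ≡ parity (sumWith g v) xor parity m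
parity-sumWith-map g h flips []            = refl
parity-sumWith-map g h flips {suc m} (x ∷ v) = begin
  parity (g (h x) + sumWith g (map h v))            ≡⟨ parity-+ (g (h x)) _ ⟩
  parity (g (h x)) xor parity (sumWith g (map h v)) ≡⟨ cong₂ _xor_ (flips x) (parity-sumWith-map g h flips v) ⟩
  not (parity (g x)) xor (parity (sumWith g v) xor parity m)
    ≡⟨ sym (not-distribˡ-xor (parity (g x)) _) ⟩
  not (parity (g x) xor (parity (sumWith g v) xor parity m))
    ≡⟨ cong not (sym (xor-assoc (parity (g x)) _ _)) ⟩
  not ((parity (g x) xor parity (sumWith g v)) xor parity m)
    ≡⟨ not-distribʳ-xor (parity (g x) xor _) (parity m) ⟩
  (parity (g x) xor parity (sumWith g v)) xor not (parity m)
    ≡⟨ cong (_xor not (parity m)) (sym (parity-+ (g x) _)) ⟩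
  parity (g x + sumWith g v) xor not (parity m) ∎
  where open ≡-Reasoning

allBool : List Bool
allBool = false ∷ true ∷ []

_≟ᵇ_ : ∀ {m} → DecidableEquality (Vec Bool m)
_≟ᵇ_ = ≡-dec Bool._≟_

_≟ᵛ_ : ∀ {m} → DecidableEquality (Vec Σ₄ m)
_≟ᵛ_ = ≡-dec _≟F_

𝟙-even-alternates : ∀ s → 𝟙 (even? s) + 𝟙 (even? (suc s)) ≡ 1
𝟙-even-alternates zero    = refl
𝟙-even-alternates (suc s) = trans (+-comm (𝟙 (even? (suc s))) _) (𝟙-even-alternates s)

∑-label-fibre : ∀ m (w : Vec Bool m) → ∑[ c ∈ vecsOf allΣ₄ m ] 𝟙 (map l c ≟ᵇ w) ≡ 2 ^ m
∑-label-fibre = ∑-fibre-vecsOf Bool._≟_ l allΣ₄ 2 λ { false → refl ; true → refl }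

+-identityʳ-twice : ∀ a b → a + 0 + (b + 0 + 0) ≡ a + b
+-identityʳ-twice a b = cong₂ _+_ (+-identityʳ a) (trans (+-identityʳ _) (+-identityʳ b))

-- Each label is carried by two symbols of opposite parity.
∑-label-parity : ∀ y s → ∑[ x ∈ allΣ₄ ] 𝟙 (l x Bool.≟ y) * 𝟙 (even? (toℕ x + s)) ≡ 1
∑-label-parity false s = trans (+-identityʳ-twice (𝟙 (even? s)) _) (𝟙-even-alternates s)
∑-label-parity true  s = trans (+-identityʳ-twice (𝟙 (even? s)) _) (𝟙-even-alternates s)

∑-label-fibre-even : ∀ m (w : Vec Bool (suc m)) s →
  ∑[ c ∈ vecsOf allΣ₄ (suc m) ] 𝟙 (map l c ≟ᵇ w) * 𝟙 (even? (sumΣ c + s)) ≡ 2 ^ m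
∑-label-fibre-even m (y ∷ w) s = begin
  ∑[ c ∈ vecsOf allΣ₄ (suc m) ] 𝟙 (map l c ≟ᵇ (y ∷ w)) * 𝟙 (even? (sumΣ c + s))
    ≡⟨ ∑-vecsOf-suc allΣ₄ m _ ⟩
  ∑[ x ∈ allΣ₄ ] ∑[ c ∈ cs ] 𝟙 (l x Bool.≟ y ×-dec map l c ≟ᵇ w) * 𝟙 (even? (toℕ x + sumΣ c + s))
    ≡⟨ ∑-cong allΣ₄ (λ x → ∑-cong cs (λ c → separate x c)) ⟩
  ∑[ x ∈ allΣ₄ ] ∑[ c ∈ cs ] 𝟙 (map l c ≟ᵇ w) * E c x
    ≡⟨ ∑-comm allΣ₄ cs (λ x c → 𝟙 (map l c ≟ᵇ w) * E c x) ⟩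
  ∑[ c ∈ cs ] ∑[ x ∈ allΣ₄ ] 𝟙 (map l c ≟ᵇ w) * E c x
    ≡⟨ ∑-cong cs (λ c → ∑-*ˡ allΣ₄ (𝟙 (map l c ≟ᵇ w)) (E c)) ⟩
  ∑[ c ∈ cs ] 𝟙 (map l c ≟ᵇ w) * ∑ allΣ₄ (E c)
    ≡⟨ ∑-cong cs (λ c → trans (cong (𝟙 (map l c ≟ᵇ w) *_) (∑-label-parity y (sumΣ c + s))) (*-identityʳ _)) ⟩
  ∑[ c ∈ cs ] 𝟙 (map l c ≟ᵇ w)
    ≡⟨ ∑-label-fibre m w ⟩
  2 ^ m ∎
  where
  open ≡-Reasoning
  cs = vecsOf allΣ₄ m
  E : Vec Σ₄ m → Σ₄ → ℕ
  E c x = 𝟙 (l x Bool.≟ y) * 𝟙 (even? (toℕ x + (sumΣ c + s)))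
  separate : ∀ x c → 𝟙 (l x Bool.≟ y ×-dec map l c ≟ᵇ w) * 𝟙 (even? (toℕ x + sumΣ c + s))
                   ≡ 𝟙 (map l c ≟ᵇ w) * E c x
  separate x c = begin
    𝟙 (l x Bool.≟ y ×-dec map l c ≟ᵇ w) * 𝟙 (even? (toℕ x + sumΣ c + s))
      ≡⟨ cong₂ _*_ (𝟙-× (l x Bool.≟ y) (map l c ≟ᵇ w)) (cong (𝟙 ∘ even?) (+-assoc (toℕ x) (sumΣ c) s)) ⟩
    𝟙 (l x Bool.≟ y) * 𝟙 (map l c ≟ᵇ w) * 𝟙 (even? (toℕ x + (sumΣ c + s)))
      ≡⟨ *-xy∙z≈y∙xz (𝟙 (l x Bool.≟ y)) _ _ ⟩
    𝟙 (map l c ≟ᵇ w) * E c x ∎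

∑-even-weight : ∀ m s → ∑[ w ∈ vecsOf allBool (suc m) ] 𝟙 (even? (weight w + s)) ≡ 2 ^ m
∑-even-weight zero    s = trans (cong (𝟙 (even? s) +_) (+-identityʳ _)) (𝟙-even-alternates s)
∑-even-weight (suc m) s = begin
  ∑[ w ∈ vecsOf allBool (suc (suc m)) ] 𝟙 (even? (weight w + s))
    ≡⟨ ∑-vecsOf-suc allBool (suc m) (λ w → 𝟙 (even? (weight w + s))) ⟩
  ∑[ b ∈ allBool ] ∑[ w ∈ vecsOf allBool (suc m) ] 𝟙 (even? (b2n b + weight w + s))
    ≡⟨ ∑-cong allBool (λ b → ∑-cong (vecsOf allBool (suc m)) (λ w →
         cong (𝟙 ∘ even?) (+-xy∙z≈y∙xz (b2n b) (weight w) s))) ⟩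
  ∑[ b ∈ allBool ] ∑[ w ∈ vecsOf allBool (suc m) ] 𝟙 (even? (weight w + (b2n b + s)))
    ≡⟨ ∑-cong allBool (λ b → ∑-even-weight m (b2n b + s)) ⟩
  2 * 2 ^ m ∎
  where open ≡-Reasoning

Apart : ∀ {m} → Vec Σ₄ m → Vec Σ₄ m → Set
Apart = Pointwise _≢_

Opposite : ∀ {m} → Vec Σ₄ m → Vec Σ₄ m → Set
Opposite a c = map l c ≡ map not (map l a)

apart-sym : ∀ {m} {a b : Vec Σ₄ m} → Apart a b → Apart b a
apart-sym = Pointwise.sym (λ x≢y y≡x → x≢y (sym y≡x))

apart-mate : ∀ {m} (a : Vec Σ₄ m) → Apart a (map mate a)
apart-mate []      = []
apart-mate (x ∷ a) = mate-≢ x ∷ apart-mate a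

map-l-mate : ∀ {m} (a : Vec Σ₄ m) → map l (map mate a) ≡ map l a
map-l-mate []      = refl
map-l-mate (x ∷ a) = cong₂ _∷_ (l-mate x) (map-l-mate a)

apart-same-labels⇒mate : ∀ {m} {a b : Vec Σ₄ m} → Apart a b → map l a ≡ map l b → b ≡ map mate a
apart-same-labels⇒mate []             _    = refl
apart-same-labels⇒mate (x≢y ∷ a-apart-b) la≡lb with ∷-injective la≡lb
... | lx≡ly , la≡lb′ = cong₂ _∷_ (same-label⇒mate x≢y lx≡ly) (apart-same-labels⇒mate a-apart-b la≡lb′)

apart-from-mates⇒opposite : ∀ {m} {a c : Vec Σ₄ m} → Apart a c → Apart (map mate a) c → Opposite a c
apart-from-mates⇒opposite []                []                  = refl
apart-from-mates⇒opposite (x≢y ∷ a-apart-c) (mx≢y ∷ ma-apart-c) =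
  cong₂ _∷_ (other-label x≢y mx≢y) (apart-from-mates⇒opposite a-apart-c ma-apart-c)

opposite⇒apart : ∀ {m} (a c : Vec Σ₄ m) → Opposite a c → Apart a c
opposite⇒apart []      []      _        = []
opposite⇒apart (x ∷ a) (y ∷ c) opposite with ∷-injective opposite
... | ly≡not , lc≡not = other-label⇒≢ ly≡not ∷ opposite⇒apart a c lc≡not

opposite-mateˡ : ∀ {m} {a c : Vec Σ₄ m} → Opposite a c → Opposite (map mate a) c
opposite-mateˡ {a = a} opposite = trans opposite (cong (map not) (sym (map-l-mate a)))

opposite-mateʳ : ∀ {m} {a c : Vec Σ₄ m} → Opposite a c → Opposite a (map mate c)
opposite-mateʳ {c = c} opposite = trans (map-l-mate c) opposite

≢-map-not : ∀ {m} (u : Vec Bool (suc m)) → u ≢ map not u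
≢-map-not (false ∷ u) ()
≢-map-not (true ∷ u)  ()

MatedLabels : ∀ {m} → Vec Bool m → Vec Bool m → Vec Bool m → Vec Bool m → Set
MatedLabels u p q r = p ≡ u × q ≡ map not u × r ≡ map not u

module _ {m} (u : Vec Bool m) (evens : Even (weight u) × Even (weight (map not u))) where
  private
    ū = map not u
    even-u = proj₁ evens
    even-ū = proj₂ evens

  twin-uuūū : ∀ {p q r} → MatedLabels u p q r → Twin (u ∷ p ∷ q ∷ r ∷ [])
  twin-uuūū (refl , refl , refl) =
    (proper , λ { zero → even-u ; (suc zero) → even-u ; (suc (suc zero)) → even-ū ; (suc (suc (suc zero))) → even-ū })
    , inj₁ (refl , refl)
    where
    proper : Proper (u ∷ u ∷ ū ∷ ū ∷ [])
    proper k rewrite lookup-map k not u with lookup u k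
    ... | false = refl
    ... | true  = refl

  twin-uūuū : ∀ {p q r} → MatedLabels u q p r → Twin (u ∷ p ∷ q ∷ r ∷ [])
  twin-uūuū (refl , refl , refl) =
    (proper , λ { zero → even-u ; (suc zero) → even-ū ; (suc (suc zero)) → even-u ; (suc (suc (suc zero))) → even-ū })
    , inj₂ (inj₁ (refl , refl))
    where
    proper : Proper (u ∷ ū ∷ u ∷ ū ∷ [])
    proper k rewrite lookup-map k not u with lookup u k
    ... | false = refl
    ... | true  = refl

  twin-uūūu : ∀ {p q r} → MatedLabels u r p q → Twin (u ∷ p ∷ q ∷ r ∷ [])
  twin-uūūu (refl , refl , refl) =
    (proper , λ { zero → even-u ; (suc zero) → even-ū ; (suc (suc zero)) → even-ū ; (suc (suc (suc zero))) → even-u })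
    , inj₂ (inj₂ (refl , refl))
    where
    proper : Proper (u ∷ ū ∷ ū ∷ u ∷ [])
    proper k rewrite lookup-map k not u with lookup u k
    ... | false = refl
    ... | true  = refl

value-even-label : ∀ {n λf} {a : Vec Σ₄ (suc n)} → IsValue λf a → Even (weight (map l a))
value-even-label {a = x ∷ xs} (even-label , _) = even-label

module _ {n : ℕ} (n-odd : Odd n) where

  parity-sumWith-map-suc : ∀ (g : A → ℕ) (h : A → A) → (∀ x → parity (g (h x)) ≡ not (parity (g x))) →
                           (v : Vec A (suc n)) → parity (sumWith g (map h v)) ≡ parity (sumWith g v)
  parity-sumWith-map-suc g h flips v =
    trans (parity-sumWith-map g h flips v)
          (trans (cong (parity (sumWith g v) xor_) (cong not (odd⇒parity≡true n n-odd))) (xor-identityʳ _))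

  even-complement : (u : Vec Bool (suc n)) → Even (weight u) → Even (weight (map not u))
  even-complement u =
    even-parity-cong (weight u) (weight (map not u)) (sym (parity-sumWith-map-suc b2n not parity-b2n-not u))

  value-mate : ∀ λf (a : Vec Σ₄ (suc n)) → IsValue λf a → IsValue λf (map mate a)
  value-mate λf a@(x ∷ xs) (even-label , even-sum) =
    subst (Even ∘ weight) (sym (map-l-mate a)) even-label ,
    subst (λ v → Even (sumΣ (map mate a) + β v)) (sym (map-l-mate xs))
      (even-parity-cong (sumΣ a + β (map l xs)) (sumΣ (map mate a) + β (map l xs)) same-parity even-sum)
    where
    β = λ v → b2n (λf v)
    same-parity : parity (sumΣ a + β (map l xs)) ≡ parity (sumΣ (map mate a) + β (map l xs))
    same-parity = parity-+-congˡ (sumΣ a) (sumΣ (map mate a)) (β (map l xs))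
                    (sym (parity-sumWith-map-suc toℕ mate parity-mate a))

module _ {n : ℕ} (n-odd : Odd n) (λf : Vec Bool n → Bool) where

  private
    V = Vec Σ₄ (suc n)

  Transversal : V → V → V → V → Set
  Transversal a b c d = IsTransversal λf (a ∷ b ∷ c ∷ d ∷ [])

  data PairwiseApart (a b c d : V) : Set where
    pairwiseApart : Apart a b → Apart a c → Apart a d → Apart b c → Apart b d → Apart c d →
                    PairwiseApart a b c d

  transversal⇒pairwiseApart : ∀ {a b c d} → Transversal a b c d → PairwiseApart a b c d
  transversal⇒pairwiseApart {a} {b} {c} {d} (_ , apart) =
    pairwiseApart (at (# 0) (# 1) λ ()) (at (# 0) (# 2) λ ()) (at (# 0) (# 3) λ ())
                  (at (# 1) (# 2) λ ()) (at (# 1) (# 3) λ ()) (at (# 2) (# 3) λ ())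
    where
    at : ∀ i j → i ≢ j → Apart (lookup (a ∷ b ∷ c ∷ d ∷ []) i) (lookup (a ∷ b ∷ c ∷ d ∷ []) j)
    at i j i≢j = extensional⇒inductive (ext (apart i j i≢j))

  pairwiseApart⇒transversal : ∀ {a b c d} → IsValue λf a → IsValue λf b → IsValue λf c → IsValue λf d →
                              PairwiseApart a b c d → Transversal a b c d
  pairwiseApart⇒transversal va vb vc vd (pairwiseApart ab ac ad bc bd cd) = values , apart
    where
    values = λ { zero → va ; (suc zero) → vb ; (suc (suc zero)) → vc ; (suc (suc (suc zero))) → vd }
    apart = λ
      { zero zero i≢j → ⊥-elim (i≢j refl)
      ; zero (suc zero) _ → Pointwise.lookup ab
      ; zero (suc (suc zero)) _ → Pointwise.lookup ac
      ; zero (suc (suc (suc zero))) _ → Pointwise.lookup ad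
      ; (suc zero) zero _ → Pointwise.lookup (apart-sym ab)
      ; (suc zero) (suc zero) i≢j → ⊥-elim (i≢j refl)
      ; (suc zero) (suc (suc zero)) _ → Pointwise.lookup bc
      ; (suc zero) (suc (suc (suc zero))) _ → Pointwise.lookup bd
      ; (suc (suc zero)) zero _ → Pointwise.lookup (apart-sym ac)
      ; (suc (suc zero)) (suc zero) _ → Pointwise.lookup (apart-sym bc)
      ; (suc (suc zero)) (suc (suc zero)) i≢j → ⊥-elim (i≢j refl)
      ; (suc (suc zero)) (suc (suc (suc zero))) _ → Pointwise.lookup cd
      ; (suc (suc (suc zero))) zero _ → Pointwise.lookup (apart-sym ad)
      ; (suc (suc (suc zero))) (suc zero) _ → Pointwise.lookup (apart-sym bd)
      ; (suc (suc (suc zero))) (suc (suc zero)) _ → Pointwise.lookup (apart-sym cd)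
      ; (suc (suc (suc zero))) (suc (suc (suc zero))) i≢j → ⊥-elim (i≢j refl)
      }

  transversal-swap : ∀ {a b c d} → Transversal a b c d → Transversal a c b d
  transversal-swap t@(values , _) with transversal⇒pairwiseApart t
  ... | pairwiseApart ab ac ad bc bd cd =
    pairwiseApart⇒transversal (values (# 0)) (values (# 2)) (values (# 1)) (values (# 3))
      (pairwiseApart ac ab ad (apart-sym bc) cd bd)

  transversal-rotate : ∀ {a b c d} → Transversal a b c d → Transversal a d b c
  transversal-rotate t@(values , _) with transversal⇒pairwiseApart t
  ... | pairwiseApart ab ac ad bc bd cd =
    pairwiseApart⇒transversal (values (# 0)) (values (# 3)) (values (# 1)) (values (# 2))
      (pairwiseApart ad ab ac (apart-sym bd) (apart-sym cd) bc)

  ComplementaryValues : V → V → Set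
  ComplementaryValues a c = IsValue λf a × Opposite a c × IsValue λf c

  MatedQuad : V → V → V → V → Set
  MatedQuad a b c d = b ≡ map mate a × d ≡ map mate c × ComplementaryValues a c

  same-labels⇒mated : ∀ {a b c d} → Transversal a b c d → map l a ≡ map l b → map l c ≡ map l d →
                      MatedQuad a b c d
  same-labels⇒mated {c = c} t@(values , _) la≡lb lc≡ld with transversal⇒pairwiseApart t
  ... | pairwiseApart ab ac _ bc _ cd =
    b≡mate-a , apart-same-labels⇒mate cd lc≡ld ,
    values (# 0) , apart-from-mates⇒opposite ac (subst (λ b → Apart b c) b≡mate-a bc) , values (# 2)
    where b≡mate-a = apart-same-labels⇒mate ab la≡lb

  mated⇒transversal : ∀ {a b c d} → MatedQuad a b c d → Transversal a b c d
  mated⇒transversal {a} {c = c} (refl , refl , va , opposite , vc) =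
    pairwiseApart⇒transversal va (value-mate n-odd λf a va) vc (value-mate n-odd λf c vc)
      (pairwiseApart (apart-mate a) (opposite⇒apart _ _ opposite) (opposite⇒apart _ _ (opposite-mateʳ opposite))
                     (opposite⇒apart _ _ (opposite-mateˡ opposite))
                     (opposite⇒apart _ _ (opposite-mateˡ (opposite-mateʳ opposite))) (apart-mate c))

  mated-labels : ∀ {a b c d} → MatedQuad a b c d → MatedLabels (map l a) (map l b) (map l c) (map l d)
  mated-labels {a} {c = c} (refl , refl , _ , opposite , _) = map-l-mate a , opposite , opposite-mateʳ opposite

  mated-even-labels : ∀ {a b c d} → MatedQuad a b c d → Even (weight (map l a)) × Even (weight (map not (map l a)))
  mated-even-labels {a} (_ , _ , va , _) = even-label , even-complement n-odd (map l a) even-label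
    where even-label = value-even-label {λf = λf} {a} va

  twinTransversal⇒mated : ∀ {a b c d} → TwinTransversal λf (a ∷ b ∷ c ∷ d ∷ []) →
                          MatedQuad a b c d ⊎ MatedQuad a c b d ⊎ MatedQuad a d b c
  twinTransversal⇒mated (t , _ , inj₁ (la≡lb , lc≡ld))        = inj₁ (same-labels⇒mated t la≡lb lc≡ld)
  twinTransversal⇒mated (t , _ , inj₂ (inj₁ (la≡lc , lb≡ld))) =
    inj₂ (inj₁ (same-labels⇒mated (transversal-swap t) la≡lc lb≡ld))
  twinTransversal⇒mated (t , _ , inj₂ (inj₂ (la≡ld , lb≡lc))) =
    inj₂ (inj₂ (same-labels⇒mated (transversal-rotate t) la≡ld lb≡lc))

  mated⇒twinTransversal : ∀ {a b c d} → MatedQuad a b c d ⊎ MatedQuad a c b d ⊎ MatedQuad a d b c →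
                          TwinTransversal λf (a ∷ b ∷ c ∷ d ∷ [])
  mated⇒twinTransversal (inj₁ m) =
    mated⇒transversal m ,
    twin-uuūū _ (mated-even-labels m) (mated-labels m)
  mated⇒twinTransversal (inj₂ (inj₁ m)) =
    transversal-swap (mated⇒transversal m) ,
    twin-uūuū _ (mated-even-labels m) (mated-labels m)
  mated⇒twinTransversal (inj₂ (inj₂ m)) =
    transversal-rotate (transversal-rotate (mated⇒transversal m)) ,
    twin-uūūu _ (mated-even-labels m) (mated-labels m)

  label-clash : ∀ {a x : V} → map l x ≡ map l a → map l x ≡ map not (map l a) → ⊥
  label-clash {a} lx≡la lx≡not = ≢-map-not (map l a) (trans (sym lx≡la) lx≡not)

  complementary? : ∀ a c → Dec (ComplementaryValues a c)
  complementary? a c = isValue? λf a ×-dec (map l c ≟ᵇ map not (map l a) ×-dec isValue? λf c)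

  mated? : ∀ a b c d → Dec (MatedQuad a b c d)
  mated? a b c d = b ≟ᵛ map mate a ×-dec (d ≟ᵛ map mate c ×-dec complementary? a c)

  twinTransversal? : ∀ α → Dec (TwinTransversal λf α)
  twinTransversal? α = isTransversal? λf α ×-dec twin? (map (map l) α)

  𝟙-twinTransversal : ∀ a b c d → 𝟙 (twinTransversal? (a ∷ b ∷ c ∷ d ∷ [])) ≡
                      𝟙 (mated? a b c d) + (𝟙 (mated? a c b d) + 𝟙 (mated? a d b c))
  𝟙-twinTransversal a b c d = begin
    𝟙 (twinTransversal? (a ∷ b ∷ c ∷ d ∷ []))
      ≡⟨ 𝟙-cong (twinTransversal? _) (M₁ ⊎-dec (M₂ ⊎-dec M₃)) twinTransversal⇒mated mated⇒twinTransversal ⟩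
    𝟙 (M₁ ⊎-dec (M₂ ⊎-dec M₃))
      ≡⟨ 𝟙-⊎ M₁ (M₂ ⊎-dec M₃) exclusive₁ ⟩
    𝟙 M₁ + 𝟙 (M₂ ⊎-dec M₃)
      ≡⟨ cong (𝟙 M₁ +_) (𝟙-⊎ M₂ M₃ exclusive₂) ⟩
    𝟙 M₁ + (𝟙 M₂ + 𝟙 M₃) ∎
    where
    open ≡-Reasoning
    M₁ = mated? a b c d
    M₂ = mated? a c b d
    M₃ = mated? a d b c
    exclusive₁ : ¬ (MatedQuad a b c d × (MatedQuad a c b d ⊎ MatedQuad a d b c))
    exclusive₁ (m , m′) with mated-labels m | m′
    ... | lb≡la , _ | inj₁ m₂ = label-clash lb≡la (proj₁ (proj₂ (mated-labels m₂)))
    ... | lb≡la , _ | inj₂ m₃ = label-clash lb≡la (proj₁ (proj₂ (mated-labels m₃)))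
    exclusive₂ : ¬ (MatedQuad a c b d × MatedQuad a d b c)
    exclusive₂ (m₂ , m₃) = label-clash (proj₁ (mated-labels m₃)) (proj₂ (proj₂ (mated-labels m₂)))

  points : List V
  points = vecsOf allΣ₄ (suc n)

  ∑-δ : ∀ (w : V) K → ∑[ v ∈ points ] 𝟙 (v ≟ᵛ w) * K ≡ K
  ∑-δ = ∑-δ-vecsOf _≟F_ allΣ₄
          (λ { zero → refl ; (suc zero) → refl ; (suc (suc zero)) → refl ; (suc (suc (suc zero))) → refl })
          (suc n)

  ∑-mated : ∀ a → ∑³ points (λ b c d → 𝟙 (mated? a b c d)) ≡ ∑[ c ∈ points ] 𝟙 (complementary? a c)
  ∑-mated a = begin
    ∑[ b ∈ points ] ∑[ c ∈ points ] ∑[ d ∈ points ] 𝟙 (mated? a b c d)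
      ≡⟨ ∑-cong points (λ b → ∑-cong points (λ c → ∑-cong points (λ d → 𝟙-mated b c d))) ⟩
    ∑[ b ∈ points ] ∑[ c ∈ points ] ∑[ d ∈ points ] 𝟙 (b ≟ᵛ map mate a) * (𝟙 (d ≟ᵛ map mate c) * K c)
      ≡⟨ ∑-cong points (λ b → ∑-cong points (λ c → ∑-*ˡ points (𝟙 (b ≟ᵛ map mate a)) _)) ⟩
    ∑[ b ∈ points ] ∑[ c ∈ points ] 𝟙 (b ≟ᵛ map mate a) * (∑[ d ∈ points ] 𝟙 (d ≟ᵛ map mate c) * K c)
      ≡⟨ ∑-cong points (λ b → ∑-cong points (λ c → cong (𝟙 (b ≟ᵛ map mate a) *_) (∑-δ (map mate c) (K c)))) ⟩
    ∑[ b ∈ points ] ∑[ c ∈ points ] 𝟙 (b ≟ᵛ map mate a) * K c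
      ≡⟨ ∑-cong points (λ b → ∑-*ˡ points (𝟙 (b ≟ᵛ map mate a)) K) ⟩
    ∑[ b ∈ points ] 𝟙 (b ≟ᵛ map mate a) * ∑ points K
      ≡⟨ ∑-δ (map mate a) (∑ points K) ⟩
    ∑ points K ∎
    where
    open ≡-Reasoning
    K = λ c → 𝟙 (complementary? a c)
    𝟙-mated : ∀ b c d → 𝟙 (mated? a b c d) ≡ 𝟙 (b ≟ᵛ map mate a) * (𝟙 (d ≟ᵛ map mate c) * K c)
    𝟙-mated b c d =
      trans (𝟙-× (b ≟ᵛ map mate a) (d ≟ᵛ map mate c ×-dec complementary? a c))
            (cong (𝟙 (b ≟ᵛ map mate a) *_) (𝟙-× (d ≟ᵛ map mate c) (complementary? a c)))

  ∑-labelled-values : ∀ y w → ∑[ c ∈ points ] 𝟙 (map l c ≟ᵇ (y ∷ w)) * 𝟙 (isValue? λf c)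
                              ≡ 𝟙 (even? (weight (y ∷ w))) * 2 ^ n
  ∑-labelled-values y w = begin
    ∑[ c ∈ points ] 𝟙 (map l c ≟ᵇ (y ∷ w)) * 𝟙 (isValue? λf c)
      ≡⟨ ∑-cong points (λ c → trans (𝟙-guard (map l c ≟ᵇ (y ∷ w)) (𝟙-value c))
                                     (*-x∙yz≈y∙xz (𝟙 (map l c ≟ᵇ (y ∷ w))) E (𝟙 (even? (sumΣ c + b2n (λf w)))))) ⟩
    ∑[ c ∈ points ] E * (𝟙 (map l c ≟ᵇ (y ∷ w)) * 𝟙 (even? (sumΣ c + b2n (λf w))))
      ≡⟨ ∑-*ˡ points E _ ⟩
    E * (∑[ c ∈ points ] 𝟙 (map l c ≟ᵇ (y ∷ w)) * 𝟙 (even? (sumΣ c + b2n (λf w))))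
      ≡⟨ cong (E *_) (∑-label-fibre-even n (y ∷ w) (b2n (λf w))) ⟩
    E * 2 ^ n ∎
    where
    open ≡-Reasoning
    E = 𝟙 (even? (weight (y ∷ w)))
    𝟙-value : ∀ c → map l c ≡ y ∷ w → 𝟙 (isValue? λf c) ≡ E * 𝟙 (even? (sumΣ c + b2n (λf w)))
    𝟙-value (x ∷ xs) refl =
      𝟙-× (even? (weight (map l (x ∷ xs)))) (even? (sumΣ (x ∷ xs) + b2n (λf (map l xs))))

  ∑-complementary : ∀ a → ∑[ c ∈ points ] 𝟙 (complementary? a c) ≡ 𝟙 (isValue? λf a) * 2 ^ n
  ∑-complementary a@(x ∷ xs) = begin
    ∑[ c ∈ points ] 𝟙 (complementary? a c)
      ≡⟨ ∑-cong points (λ c → trans (𝟙-× (isValue? λf a) (map l c ≟ᵇ ū ×-dec isValue? λf c))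
                                     (cong (𝟙 (isValue? λf a) *_) (𝟙-× (map l c ≟ᵇ ū) (isValue? λf c)))) ⟩
    ∑[ c ∈ points ] 𝟙 (isValue? λf a) * (𝟙 (map l c ≟ᵇ ū) * 𝟙 (isValue? λf c))
      ≡⟨ ∑-*ˡ points (𝟙 (isValue? λf a)) _ ⟩
    𝟙 (isValue? λf a) * (∑[ c ∈ points ] 𝟙 (map l c ≟ᵇ ū) * 𝟙 (isValue? λf c))
      ≡⟨ cong (𝟙 (isValue? λf a) *_) (∑-labelled-values (not (l x)) (map not (map l xs))) ⟩
    𝟙 (isValue? λf a) * (𝟙 (even? (weight ū)) * 2 ^ n)
      ≡⟨ 𝟙-guard (isValue? λf a) (λ va →
           trans (cong (_* 2 ^ n) (𝟙-yes (even? (weight ū)) (even-complement n-odd (map l a) (value-even-label {λf = λf} {a} va))))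
                 (*-identityˡ (2 ^ n))) ⟩
    𝟙 (isValue? λf a) * 2 ^ n ∎
    where
    open ≡-Reasoning
    ū = map not (map l a)

  ∑-values : ∑[ a ∈ points ] 𝟙 (isValue? λf a) ≡ 2 ^ n * 2 ^ n
  ∑-values = begin
    ∑[ a ∈ points ] 𝟙 (isValue? λf a)
      ≡⟨ ∑-cong points (λ a → sym (∑-δ-vecsOf Bool._≟_ allBool (λ { false → refl ; true → refl })
                                                (suc n) (map l a) (𝟙 (isValue? λf a)))) ⟩
    ∑[ a ∈ points ] ∑[ w ∈ labels ] 𝟙 (w ≟ᵇ map l a) * 𝟙 (isValue? λf a)
      ≡⟨ ∑-comm points labels _ ⟩
    ∑[ w ∈ labels ] ∑[ a ∈ points ] 𝟙 (w ≟ᵇ map l a) * 𝟙 (isValue? λf a)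
      ≡⟨ ∑-cong labels (λ w → ∑-cong points (λ a →
           cong (_* 𝟙 (isValue? λf a)) (𝟙-cong (w ≟ᵇ map l a) (map l a ≟ᵇ w) sym sym))) ⟩
    ∑[ w ∈ labels ] ∑[ a ∈ points ] 𝟙 (map l a ≟ᵇ w) * 𝟙 (isValue? λf a)
      ≡⟨ ∑-cong labels (λ { (y ∷ w) → ∑-labelled-values y w }) ⟩
    ∑[ w ∈ labels ] 𝟙 (even? (weight w)) * 2 ^ n
      ≡⟨ ∑-*ʳ labels (2 ^ n) (λ w → 𝟙 (even? (weight w))) ⟩
    (∑[ w ∈ labels ] 𝟙 (even? (weight w))) * 2 ^ n
      ≡⟨ cong (_* 2 ^ n) (trans (∑-cong labels (λ w → cong (𝟙 ∘ even?) (sym (+-identityʳ (weight w)))))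
                                (∑-even-weight n 0)) ⟩
    2 ^ n * 2 ^ n ∎
    where
    open ≡-Reasoning
    labels = vecsOf allBool (suc n)

  ∑-twinTransversals : ∀ a → ∑³ points (λ b c d → 𝟙 (twinTransversal? (a ∷ b ∷ c ∷ d ∷ [])))
                             ≡ 3 * (𝟙 (isValue? λf a) * 2 ^ n)
  ∑-twinTransversals a = begin
    ∑³ points (λ b c d → 𝟙 (twinTransversal? (a ∷ b ∷ c ∷ d ∷ [])))
      ≡⟨ ∑-cong points (λ b → ∑-cong points (λ c → ∑-cong points (λ d → 𝟙-twinTransversal a b c d))) ⟩
    ∑³ points (λ b c d → 𝟙 (mated? a b c d) + (𝟙 (mated? a c b d) + 𝟙 (mated? a d b c)))
      ≡⟨ ∑³-+ points M (λ b c d → 𝟙 (mated? a c b d) + 𝟙 (mated? a d b c)) ⟩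
    ∑³ points M + ∑³ points (λ b c d → 𝟙 (mated? a c b d) + 𝟙 (mated? a d b c))
      ≡⟨ cong (∑³ points M +_) (trans (∑³-+ points _ _)
                                      (cong₂ _+_ (∑³-swap₁₂ points M) (∑³-rotate points M))) ⟩
    ∑³ points M + (∑³ points M + ∑³ points M)
      ≡⟨ cong (λ s → s + (s + s)) (trans (∑-mated a) (∑-complementary a)) ⟩
    v + (v + v)
      ≡⟨ cong (λ s → v + (v + s)) (sym (+-identityʳ v)) ⟩
    3 * v ∎
    where
    open ≡-Reasoning
    M = λ b c d → 𝟙 (mated? a b c d)
    v = 𝟙 (isValue? λf a) * 2 ^ n

  count-twinTransversals : countOrderedTwinTransversals n λf ≡ 3 * 8 ^ n
  count-twinTransversals = begin
    length (filter twinTransversal? (allQuads n))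
      ≡⟨ length-filter≡∑ twinTransversal? (allQuads n) ⟩
    ∑[ α ∈ allQuads n ] 𝟙 (twinTransversal? α)
      ≡⟨ ∑-quads points (𝟙 ∘ twinTransversal?) ⟩
    ∑[ a ∈ points ] ∑³ points (λ b c d → 𝟙 (twinTransversal? (a ∷ b ∷ c ∷ d ∷ [])))
      ≡⟨ ∑-cong points ∑-twinTransversals ⟩
    ∑[ a ∈ points ] 3 * (𝟙 (isValue? λf a) * 2 ^ n)
      ≡⟨ ∑-*ˡ points 3 _ ⟩
    3 * (∑[ a ∈ points ] 𝟙 (isValue? λf a) * 2 ^ n)
      ≡⟨ cong (3 *_) (trans (∑-*ʳ points (2 ^ n) (𝟙 ∘ isValue? λf)) (cong (_* 2 ^ n) ∑-values)) ⟩
    3 * (2 ^ n * 2 ^ n * 2 ^ n)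
      ≡⟨ cong (3 *_) (sym (trans (^-distribʳ-* 4 2 n) (cong (_* 2 ^ n) (^-distribʳ-* 2 2 n)))) ⟩
    3 * 8 ^ n ∎
    where open ≡-Reasoning

lemma7 : (n : ℕ) → Odd n → (λf : Vec Bool n → Bool) →
    countOrderedTwinTransversals n λf ≡ 24 * 8 ^ (n ∸ 1)
lemma7 zero    ()    λf
lemma7 (suc k) n-odd λf = trans (count-twinTransversals n-odd λf) (sym (*-assoc 3 8 (8 ^ k)))
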